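{- For inputs $G,\Delta,U,h,w$ with $w\ge 2$ and $\Delta(v)\le w\,d(v)$ for all $v$, the running time of Unit-Flow is $O(w\,|\Delta(\cdot)|\,h)$, where $|\Delta(\cdot)|=\sum_v\Delta(v)$.
   Context: $G=(V,E)$ is an undirected multigraph (no self-loops), $d(v)$ its degree. Unit-Flow$(G,\Delta,U,h,w)$: inputs are a source function $\Delta:V\to\mathbb{Z}_{\ge 0}$, an integer edge capacity $U>0$, an integer label bound $h$, and an integer $w\ge 2$; each vertex $v$ is a sink of capacity $d(v)$. It maintains a pre-flow $f$ with $f(v,u)=-f(u,v)$, $|f(v,u)|\le U$ per edge, residual capacities $r_f(v,u)=U-f(v,u)$, supply $f(v)=\Delta(v)+\sum_u f(u,v)$ and excess $\operatorname{ex}(v)=\max(f(v)-d(v),0)$. Labels $l(v)$ start at $0$; each vertex has a current-edge pointer initially at the first edge in its incidence list. A vertex is active if $l(v)<h$ and $\operatorname{ex}(v)>0$; active vertices are kept in a queue ordered by label. While some vertex is active, take an active vertex $v$ of minimum label with current edge $\{v,u\}$: if $\operatorname{ex}(v)>0$, $r_f(v,u)>0$, $l(v)=l(u)+1$, push $\psi=\min(\operatorname{ex}(v),r_f(v,u),w\,d(u)-f(u))$ units from $v$ to $u$; otherwise advance the current edge, or, if it was the last edge, increment $l(v)$ and reset the pointer to the first edge. Stop when no vertex is active. Units of supply are treated as distinct tokens carrying marks (e.g. their origin), so pushing $\psi$ units costs $\Theta(\psi)$ work; $\Delta$ is given in a compact representation. -}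

module Defs where

open import Data.Nat as ℕ using (ℕ; zero; suc; _≤_; _<_)
open import Data.Integer as ℤ using (ℤ; +_; -_; _⊓_; ∣_∣)
open import Data.Fin using (Fin; _≟_)
open import Data.List using (List; []; _∷_; filter; length; foldr; map)
open import Data.List.Base using (allFin)
open import Data.List.Relation.Binary.Permutation.Propositional using (_↭_)
open import Data.Product using (Σ; _×_; _,_; proj₁; proj₂; ∃)
open import Data.Sum using (_⊎_)
open import Data.Maybe using (Maybe; just; nothing)
open import Data.Bool using (if_then_else_)
open import Relation.Binary.PropositionalEquality using (_≡_; _≢_)
open import Relation.Nullary using (¬_; does)
open import Relation.Nullary.Decidable using (_⊎-dec_)

-- Each edge e has endpoints ends e (the order only fixes an orientation used
-- to store the antisymmetric flow).
Incident : {n m : ℕ} → (Fin m → Fin n × Fin n) → Fin n → Fin m → Set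
Incident ends v e = (proj₁ (ends e) ≡ v) ⊎ (proj₂ (ends e) ≡ v)

incident? : {n m : ℕ} (ends : Fin m → Fin n × Fin n) (v : Fin n) (e : Fin m) →
            Relation.Nullary.Dec (Incident ends v e)
incident? ends v e = (proj₁ (ends e) ≟ v) ⊎-dec (proj₂ (ends e) ≟ v)

record Graph : Set where
  field
    n m    : ℕ
    ends   : Fin m → Fin n × Fin n
    noLoop : ∀ e → proj₁ (ends e) ≢ proj₂ (ends e)
    inc    : Fin n → List (Fin m)
    incOK  : ∀ v → inc v ↭ filter (incident? ends v) (allFin m)

  deg : Fin n → ℕ
  deg v = length (filter (incident? ends v) (allFin m))

  other : Fin m → Fin n → Fin n
  other e v = if does (proj₁ (ends e) ≟ v) then proj₂ (ends e) else proj₁ (ends e)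

sumℤ : List ℤ → ℤ
sumℤ = foldr ℤ._+_ (+ 0)

sumℕ : List ℕ → ℕ
sumℕ = foldr ℕ._+_ 0

nth : {A : Set} → List A → ℕ → Maybe A
nth []       _       = nothing
nth (x ∷ xs) zero    = just x
nth (x ∷ xs) (suc k) = nth xs k

update : {k : ℕ} {A : Set} → (Fin k → A) → Fin k → A → Fin k → A
update g i a j = if does (j ≟ i) then a else g j

total : {n : ℕ} → (Fin n → ℕ) → ℕ
total {n} Δ = sumℕ (map Δ (allFin n))

-- Unit-Flow(G, Δ, U, h, w) as a (nondeterministic in ties) transition system
-- with a cost per iteration.
module UnitFlow (G : Graph) (Δ : Fin (Graph.n G) → ℕ) (U h w : ℕ) where
  open Graph G

  record State : Set where
    field
      f   : Fin m → ℤ      -- flow on edge e in direction proj₁ (ends e) → proj₂ (ends e)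
      l   : Fin n → ℕ
      cur : Fin n → ℕ      -- current-edge pointer (index into inc v)
  open State public

  init : State
  init = record { f = λ _ → + 0 ; l = λ _ → 0 ; cur = λ _ → 0 }

  module _ (s : State) where
    -- f(v,u) along edge e (flow sent from v to the other endpoint)
    fOut : Fin m → Fin n → ℤ
    fOut e v = if does (proj₁ (ends e) ≟ v) then f s e else - (f s e)

    supply : Fin n → ℤ
    supply v = + Δ v ℤ.+ sumℤ (map (λ e → - (fOut e v)) (filter (incident? ends v) (allFin m)))

    ex : Fin n → ℤ
    ex v = (supply v ℤ.- + deg v) ℤ.⊔ + 0

    res : Fin m → Fin n → ℤ
    res e v = + U ℤ.- fOut e v

    Active : Fin n → Set
    Active v = (l s v < h) × (+ 0 ℤ.< ex v)

    MinActive : Fin n → Set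
    MinActive v = Active v × (∀ u → Active u → l s v ≤ l s u)

    PushCond : Fin n → Fin m → Set
    PushCond v e = (+ 0 ℤ.< ex v) × (+ 0 ℤ.< res e v) × (l s v ≡ suc (l s (other e v)))

    ψ : Fin n → Fin m → ℤ
    ψ v e = ex v ⊓ res e v ⊓ (+ (w ℕ.* deg (other e v)) ℤ.- supply (other e v))

    pushState : Fin n → Fin m → State
    pushState v e = record
      { f   = update (f s) e
                (if does (proj₁ (ends e) ≟ v) then f s e ℤ.+ ψ v e else f s e ℤ.- ψ v e)
      ; l   = l s
      ; cur = cur s }

  -- One iteration of the main loop, with its cost.  A push of ψ units costs
  -- 1 + ψ (Θ(ψ) since ψ ≥ 1 in every push); advancing / relabelling costs 1.
  data Step : State → ℕ → State → Set where
    push    : ∀ {s v e} → MinActive s v → nth (inc v) (cur s v) ≡ just e → PushCond s v e →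
              Step s (suc ∣ ψ s v e ∣) (pushState s v e)
    advance : ∀ {s v} → MinActive s v →
              ¬ (∃ λ e → (nth (inc v) (cur s v) ≡ just e) × PushCond s v e) →
              suc (cur s v) < length (inc v) →
              Step s 1 (record s { cur = update (cur s) v (suc (cur s v)) })
    relabel : ∀ {s v} → MinActive s v →
              ¬ (∃ λ e → (nth (inc v) (cur s v) ≡ just e) × PushCond s v e) →
              length (inc v) ≤ suc (cur s v) →
              Step s 1 (record s { l = update (l s) v (suc (l s v)) ; cur = update (cur s) v 0 })

  -- finite executions (prefixes of a run) with accumulated cost
  data Run : State → ℕ → State → Set where
    done : ∀ {s} → Run s 0 s
    step : ∀ {s s' s'' c k} → Step s c s' → Run s' k s'' → Run s (c ℕ.+ k) s''

-- Amortised analysis.  Write S(v) for the supply of v, d(v) for its degree and W(v) = w d(v).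
-- With the potential
--   Φ = Σ_v [ l(v) (d(v) + 1) + cur(v) + 2 (W(v) - S(v)) l(v) ]
-- every iteration of cost c raises Φ by at least c: advancing a pointer or relabelling raises
-- the first two terms together by at least one without lowering the last, and pushing t units
-- from v to a neighbour one label lower raises the last term by 2t ≥ 1 + t.  Since v has
-- minimum label among active vertices, the target of a push is inactive, so it has room and
-- ψ ≥ 1.  Supplies stay within [0, W(v)]; a vertex never selected contributes 0, and a selected
-- one has d(v) ≥ 1, h ≥ 1 and S(v) ≥ d(v), so its term is at most 4wh S(v).  Supply is
-- conserved, hence Φ ≤ 4wh |Δ| bounds the total cost.
module Submission where

open import Defs
open import Data.Nat using (ℕ; _≤_; _<_; _*_)
open import Data.Fin using (Fin)
open import Data.Product using (∃)

open import Data.Nat as ℕ using (zero; suc; z≤n; s≤s)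
import Data.Nat.Properties as ℕP
import Data.Nat.Tactic.RingSolver as ℕSolver
open import Data.Integer as ℤ using (ℤ; +_; -_; +≤+)
import Data.Integer.Properties as ℤP
open import Data.Integer.Tactic.RingSolver using (solve-∀)
open import Data.Fin as Fin using (_≟_; punchIn)
open import Data.Fin.Properties using (punchInᵢ≢i)
open import Data.List using (List; []; _∷_; filter; length; map; tabulate; allFin)
open import Data.List.Properties using (map-tabulate; map-∘)
open import Data.List.Membership.Propositional using (_∈_)
open import Data.List.Membership.Propositional.Properties using (∈-filter⁺; ∈-filter⁻; ∈-allFin; ∈-length)
open import Data.List.Relation.Unary.Any using (here; there)
open import Data.List.Relation.Binary.Permutation.Propositional.Properties using (∈-resp-↭; ↭-length)
open import Data.Maybe using (just)
open import Data.Bool using (true; false; if_then_else_)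
open import Data.Bool.Properties using (if-eta)
open import Data.Product using (_×_; _,_; proj₁; proj₂)
import Data.Sum
open import Data.Sum using (_⊎_; inj₁; inj₂)
open import Function using (_∘_; id)
open import Relation.Nullary using (¬_; Dec; does; yes; no; contradiction)
open import Relation.Nullary.Decidable using (dec-true; dec-false)
open import Relation.Unary using (Decidable)
open import Relation.Binary.PropositionalEquality
open import Algebra.Properties.Semiring.Sum ℤP.+-*-semiring using (sum; sum-remove; sum-cong-≗; sum-replicate-zero; *-distribˡ-sum)

if-yes : ∀ {a p} {A : Set a} {P : Set p} (d : Dec P) → P → {x y : A} → (if does d then x else y) ≡ x
if-yes d p rewrite dec-true d p = refl

if-no : ∀ {a p} {A : Set a} {P : Set p} (d : Dec P) → ¬ P → {x y : A} → (if does d then x else y) ≡ y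
if-no d ¬p rewrite dec-false d ¬p = refl

update-≡ : ∀ {k} {A : Set} (g : Fin k → A) i a → update g i a i ≡ a
update-≡ g i a = if-yes (i ≟ i) refl

update-≢ : ∀ {k} {A : Set} (g : Fin k → A) {i} a {j} → j ≢ i → update g i a j ≡ g j
update-≢ g {i} a {j} j≢i = if-no (j ≟ i) j≢i

nth-∈ : ∀ {A : Set} (xs : List A) k {x} → nth xs k ≡ just x → x ∈ xs
nth-∈ (y ∷ ys) zero    refl = here refl
nth-∈ (y ∷ ys) (suc k) eq   = there (nth-∈ ys k eq)

sumℤ-filter : ∀ {A : Set} {P : A → Set} (P? : Decidable P) (g : A → ℤ) xs →
  sumℤ (map g (filter P? xs)) ≡ sumℤ (map (λ x → if does (P? x) then g x else + 0) xs)
sumℤ-filter P? g []       = refl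
sumℤ-filter P? g (x ∷ xs) with does (P? x)
... | true  = cong (ℤ._+_ (g x)) (sumℤ-filter P? g xs)
... | false = trans (sumℤ-filter P? g xs) (sym (ℤP.+-identityˡ _))

sumℤ-tabulate : ∀ {k} (g : Fin k → ℤ) → sumℤ (tabulate g) ≡ sum g
sumℤ-tabulate {zero}  g = refl
sumℤ-tabulate {suc k} g = cong (ℤ._+_ (g Fin.zero)) (sumℤ-tabulate (g ∘ Fin.suc))

sumℤ-allFin : ∀ {k} (g : Fin k → ℤ) → sumℤ (map g (allFin k)) ≡ sum g
sumℤ-allFin g = trans (cong sumℤ (map-tabulate id g)) (sumℤ-tabulate g)

+-sumℕ : (xs : List ℕ) → + sumℕ xs ≡ sumℤ (map +_ xs)
+-sumℕ []       = refl
+-sumℕ (x ∷ xs) = trans (ℤP.pos-+ x (sumℕ xs)) (cong (ℤ._+_ (+ x)) (+-sumℕ xs))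

+-total : ∀ {k} (Δ : Fin k → ℕ) → + total Δ ≡ sum (+_ ∘ Δ)
+-total {k} Δ = begin
  + total Δ                          ≡⟨ +-sumℕ (map Δ (allFin k)) ⟩
  sumℤ (map +_ (map Δ (allFin k)))   ≡⟨ cong sumℤ (map-∘ (allFin k)) ⟨
  sumℤ (map (+_ ∘ Δ) (allFin k))     ≡⟨ sumℤ-allFin (+_ ∘ Δ) ⟩
  sum (+_ ∘ Δ)                       ∎
  where open ≡-Reasoning

sum-mono-≤ : ∀ {k} {g g' : Fin k → ℤ} → (∀ x → g x ℤ.≤ g' x) → sum g ℤ.≤ sum g'
sum-mono-≤ {zero}  g≤g' = ℤP.≤-refl
sum-mono-≤ {suc k} g≤g' = ℤP.+-mono-≤ (g≤g' Fin.zero) (sum-mono-≤ (g≤g' ∘ Fin.suc))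

sum-update : ∀ {k} (g g' : Fin k → ℤ) i → (∀ j → j ≢ i → g' j ≡ g j) →
  sum g' ≡ sum g ℤ.+ (g' i ℤ.- g i)
sum-update {suc k} g g' i agree = begin
  sum g'
    ≡⟨ sum-remove {i = i} g' ⟩
  g' i ℤ.+ sum (g' ∘ punchIn i)
    ≡⟨ cong (ℤ._+_ (g' i)) (sum-cong-≗ λ j → agree (punchIn i j) (punchInᵢ≢i i j)) ⟩
  g' i ℤ.+ sum (g ∘ punchIn i)
    ≡⟨ regroup (g' i) (g i) (sum (g ∘ punchIn i)) ⟩
  (g i ℤ.+ sum (g ∘ punchIn i)) ℤ.+ (g' i ℤ.- g i)
    ≡⟨ cong (ℤ._+ (g' i ℤ.- g i)) (sum-remove {i = i} g) ⟨
  sum g ℤ.+ (g' i ℤ.- g i) ∎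
  where
  open ≡-Reasoning
  regroup : ∀ a' a r → a' ℤ.+ r ≡ (a ℤ.+ r) ℤ.+ (a' ℤ.- a)
  regroup = solve-∀

sum-update₂ : ∀ {k} (g g' : Fin k → ℤ) i j → j ≢ i → (∀ x → x ≢ i → x ≢ j → g' x ≡ g x) →
  sum g' ≡ sum g ℤ.+ (g' i ℤ.- g i) ℤ.+ (g' j ℤ.- g j)
sum-update₂ g g' i j j≢i agree = begin
  sum g'
    ≡⟨ sum-update g″ g' j agree-j ⟩
  sum g″ ℤ.+ (g' j ℤ.- g″ j)
    ≡⟨ cong (λ y → sum g″ ℤ.+ (g' j ℤ.- y)) (update-≢ g (g' i) j≢i) ⟩
  sum g″ ℤ.+ (g' j ℤ.- g j)
    ≡⟨ cong (ℤ._+ (g' j ℤ.- g j)) (sum-update g g″ i (λ x → update-≢ g (g' i))) ⟩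
  sum g ℤ.+ (g″ i ℤ.- g i) ℤ.+ (g' j ℤ.- g j)
    ≡⟨ cong (λ y → sum g ℤ.+ (y ℤ.- g i) ℤ.+ (g' j ℤ.- g j)) (update-≡ g i (g' i)) ⟩
  sum g ℤ.+ (g' i ℤ.- g i) ℤ.+ (g' j ℤ.- g j) ∎
  where
  open ≡-Reasoning
  g″ : Fin _ → ℤ
  g″ = update g i (g' i)
  agree-j : ∀ x → x ≢ j → g' x ≡ g″ x
  agree-j x x≢j with x ≟ i
  ... | yes refl = refl
  ... | no  x≢i  = agree x x≢i x≢j

m<n*m : ∀ {m n} → 0 < m → 1 < n → m < n * m
m<n*m {m@(suc _)} {n} _ 1<n = subst (m <_) (ℕP.*-comm m n) (ℕP.m<m*n m n 1<n)

m<n*m⇒0<m : ∀ {m n} → m < n * m → 0 < m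
m<n*m⇒0<m {zero}  {n} 0<n*0 = contradiction (subst (0 <_) (ℕP.*-zeroʳ n) 0<n*0) λ ()
m<n*m⇒0<m {suc _} _         = s≤s z≤n

potential-bound : ∀ {w h d s L C} → 2 ≤ w → 0 < h → 0 < d → d ≤ s → L ≤ h → C ≤ d →
  L * suc d ℕ.+ C ℕ.+ 2 * ((w * d ℕ.∸ s) * L) ≤ 4 * w * h * s
potential-bound {w} {h} {d} {s} {L} {C} 2≤w 0<h 0<d d≤s L≤h C≤d = begin
  L * suc d ℕ.+ C ℕ.+ 2 * ((w * d ℕ.∸ s) * L)
    ≤⟨ ℕP.+-mono-≤ (ℕP.+-mono-≤ labels pointer) (ℕP.*-monoʳ-≤ 2 room) ⟩
  h * (w * s) ℕ.+ h * (w * s) ℕ.+ 2 * (h * (w * s))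
    ≡⟨ regroup w h s ⟩
  4 * w * h * s ∎
  where
  open ℕP.≤-Reasoning
  wd≤ws : w * d ≤ w * s
  wd≤ws = ℕP.*-monoʳ-≤ w d≤s
  labels : L * suc d ≤ h * (w * s)
  labels = ℕP.*-mono-≤ L≤h (ℕP.≤-trans (m<n*m 0<d 2≤w) wd≤ws)
  pointer : C ≤ h * (w * s)
  pointer = ℕP.≤-trans C≤d (ℕP.≤-trans d≤s (ℕP.≤-trans (ℕP.m≤n*m s w {{w≢0}}) (ℕP.m≤n*m (w * s) h {{h≢0}})))
    where
    w≢0 = ℕ.>-nonZero (ℕP.<-≤-trans (s≤s z≤n) 2≤w)
    h≢0 = ℕ.>-nonZero 0<h
  room : (w * d ℕ.∸ s) * L ≤ h * (w * s)
  room = ℕP.≤-trans (ℕP.*-mono-≤ (ℕP.≤-trans (ℕP.m∸n≤m (w * d) s) wd≤ws) L≤h)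
                    (ℕP.≤-reflexive (ℕP.*-comm (w * s) h))
  regroup : ∀ w h s → h * (w * s) ℕ.+ h * (w * s) ℕ.+ 2 * (h * (w * s)) ≡ 4 * w * h * s
  regroup = ℕSolver.solve-∀

≤-by-difference : ∀ {i j k} → + 0 ℤ.≤ k → j ℤ.- i ≡ k → i ℤ.≤ j
≤-by-difference 0≤k eq = ℤP.0≤i-j⇒j≤i (subst (+ 0 ℤ.≤_) (sym eq) 0≤k)

≤-add-difference : ∀ {c a a' r} → c ℤ.+ a ℤ.≤ a' → c ℤ.+ r ℤ.≤ r ℤ.+ (a' ℤ.- a)
≤-add-difference {c} {a} {a'} {r} gain = ≤-by-difference (ℤP.i≤j⇒0≤j-i gain) (regroup c a a' r)
  where
  regroup : ∀ c a a' r → r ℤ.+ (a' ℤ.- a) ℤ.- (c ℤ.+ r) ≡ a' ℤ.- (c ℤ.+ a)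
  regroup = solve-∀

0<i-j⇒j<i : ∀ {i j} → + 0 ℤ.< i ℤ.- j → j ℤ.< i
0<i-j⇒j<i {i} {j} 0<i-j = subst (ℤ._< i) (ℤP.+-identityˡ j) (subst (+ 0 ℤ.+ j ℤ.<_) (cancel i j) (ℤP.+-monoˡ-< j 0<i-j))
  where
  cancel : ∀ i j → i ℤ.- j ℤ.+ j ≡ i
  cancel = solve-∀

j<i⇒0<i-j : ∀ {i j} → j ℤ.< i → + 0 ℤ.< i ℤ.- j
j<i⇒0<i-j {i} {j} j<i = subst (ℤ._< i ℤ.- j) (ℤP.+-inverseʳ j) (ℤP.+-monoˡ-< (- j) j<i)

module GraphFacts (G : Graph) where
  open Graph G

  incident-of-∈ : ∀ {v e} → e ∈ inc v → Incident ends v e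
  incident-of-∈ {v} e∈inc = proj₂ (∈-filter⁻ (incident? ends v) {xs = allFin m} (∈-resp-↭ (incOK v) e∈inc))

  length-inc : ∀ v → length (inc v) ≡ deg v
  length-inc v = ↭-length (incOK v)

  deg-pos : ∀ {x e} → Incident ends x e → 0 < deg x
  deg-pos {x} {e} x∈e = ∈-length (∈-filter⁺ (incident? ends x) (∈-allFin e) x∈e)

  other-cases : ∀ e v →
    (proj₁ (ends e) ≡ v × other e v ≡ proj₂ (ends e)) ⊎ (proj₁ (ends e) ≢ v × other e v ≡ proj₁ (ends e))
  other-cases e v with proj₁ (ends e) ≟ v
  ... | yes a≡v = inj₁ (a≡v , refl)
  ... | no  a≢v = inj₂ (a≢v , refl)

  other-≢ : ∀ e v → other e v ≢ v
  other-≢ e v u≡v with other-cases e v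
  ... | inj₁ (a≡v , u≡b) = noLoop e (trans a≡v (trans (sym u≡v) u≡b))
  ... | inj₂ (a≢v , u≡a) = a≢v (trans (sym u≡a) u≡v)

  other-incident : ∀ e v → Incident ends (other e v) e
  other-incident e v with other-cases e v
  ... | inj₁ (_ , u≡b) = inj₂ (sym u≡b)
  ... | inj₂ (_ , u≡a) = inj₁ (sym u≡a)

  incident-endpoint : ∀ {v x e} → Incident ends v e → Incident ends x e → x ≢ v → x ≡ other e v
  incident-endpoint {v} {x} {e} v∈e x∈e x≢v with other-cases e v | x∈e | v∈e
  ... | inj₁ (a≡v , _)   | inj₁ a≡x | _        = contradiction (trans (sym a≡x) a≡v) x≢v
  ... | inj₁ (_ , u≡b)   | inj₂ b≡x | _        = trans (sym b≡x) (sym u≡b)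
  ... | inj₂ (_ , u≡a)   | inj₁ a≡x | _        = trans (sym a≡x) (sym u≡a)
  ... | inj₂ (a≢v , _)   | inj₂ _   | inj₁ a≡v = contradiction a≡v a≢v
  ... | inj₂ _           | inj₂ b≡x | inj₂ b≡v = contradiction (trans (sym b≡x) b≡v) x≢v

module FlowBookkeeping (G : Graph) (Δ : Fin (Graph.n G) → ℕ) (U h w : ℕ) where
  open Graph G
  open UnitFlow G Δ U h w
  open GraphFacts G

  inflow : State → Fin n → Fin m → ℤ
  inflow s x e = if does (incident? ends x e) then - fOut s e x else + 0

  supply-as-sum : ∀ s x → supply s x ≡ + Δ x ℤ.+ sum (inflow s x)
  supply-as-sum s x = cong (ℤ._+_ (+ Δ x))
    (trans (sumℤ-filter (incident? ends x) _ (allFin m)) (sumℤ-allFin (inflow s x)))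

  inflow-incident : ∀ s {x e} → Incident ends x e → inflow s x e ≡ - fOut s e x
  inflow-incident s {x} {e} x∈e = if-yes (incident? ends x e) x∈e

  inflow-not-incident : ∀ s {x e} → ¬ Incident ends x e → inflow s x e ≡ + 0
  inflow-not-incident s {x} {e} x∉e = if-no (incident? ends x e) x∉e

  fOut-other : ∀ s e v → fOut s e (other e v) ≡ - fOut s e v
  fOut-other s e v with proj₁ (ends e) ≟ v
  ... | yes _ = if-no (proj₁ (ends e) ≟ proj₂ (ends e)) (noLoop e)
  ... | no  _ = trans (if-yes (proj₁ (ends e) ≟ proj₁ (ends e)) refl) (sym (ℤP.neg-involutive (f s e)))

  module _ (s : State) (v : Fin n) (e : Fin m) where
    private
      s' : State
      s' = pushState s v e
      t : ℤ
      t = ψ s v e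
      u : Fin n
      u = other e v

    fOut-push-source : fOut s' e v ≡ fOut s e v ℤ.+ t
    fOut-push-source = by-cases (a ≟ v)
      where
      open ≡-Reasoning
      a : Fin n
      a = proj₁ (ends e)
      f-push : f s' e ≡ (if does (a ≟ v) then f s e ℤ.+ t else f s e ℤ.- t)
      f-push = update-≡ (f s) e _
      negate-difference : ∀ φ t → - (φ ℤ.- t) ≡ - φ ℤ.+ t
      negate-difference = solve-∀
      by-cases : Dec (a ≡ v) → fOut s' e v ≡ fOut s e v ℤ.+ t
      by-cases (yes a≡v) = begin
        fOut s' e v       ≡⟨ if-yes (a ≟ v) a≡v ⟩
        f s' e            ≡⟨ trans f-push (if-yes (a ≟ v) a≡v) ⟩
        f s e ℤ.+ t       ≡⟨ cong (ℤ._+ t) (if-yes (a ≟ v) a≡v) ⟨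
        fOut s e v ℤ.+ t  ∎
      by-cases (no a≢v) = begin
        fOut s' e v       ≡⟨ if-no (a ≟ v) a≢v ⟩
        - f s' e          ≡⟨ cong -_ (trans f-push (if-no (a ≟ v) a≢v)) ⟩
        - (f s e ℤ.- t)   ≡⟨ negate-difference (f s e) t ⟩
        - f s e ℤ.+ t     ≡⟨ cong (ℤ._+ t) (if-no (a ≟ v) a≢v) ⟨
        fOut s e v ℤ.+ t  ∎

    fOut-push-≢ : ∀ {e'} x → e' ≢ e → fOut s' e' x ≡ fOut s e' x
    fOut-push-≢ {e'} x e'≢e = cong (λ y → if does (proj₁ (ends e') ≟ x) then y else - y) (update-≢ (f s) _ e'≢e)

    supply-push : ∀ x → supply s' x ≡ supply s x ℤ.+ (inflow s' x e ℤ.- inflow s x e)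
    supply-push x = begin
      supply s' x
        ≡⟨ supply-as-sum s' x ⟩
      + Δ x ℤ.+ sum (inflow s' x)
        ≡⟨ cong (ℤ._+_ (+ Δ x)) (sum-update (inflow s x) (inflow s' x) e unchanged) ⟩
      + Δ x ℤ.+ (sum (inflow s x) ℤ.+ (inflow s' x e ℤ.- inflow s x e))
        ≡⟨ ℤP.+-assoc (+ Δ x) (sum (inflow s x)) (inflow s' x e ℤ.- inflow s x e) ⟨
      + Δ x ℤ.+ sum (inflow s x) ℤ.+ (inflow s' x e ℤ.- inflow s x e)
        ≡⟨ cong (ℤ._+ (inflow s' x e ℤ.- inflow s x e)) (supply-as-sum s x) ⟨
      supply s x ℤ.+ (inflow s' x e ℤ.- inflow s x e) ∎
      where
      open ≡-Reasoning
      unchanged : ∀ e' → e' ≢ e → inflow s' x e' ≡ inflow s x e'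
      unchanged e' e'≢e = cong (λ y → if does (incident? ends x e') then - y else + 0) (fOut-push-≢ x e'≢e)

    supply-push-source : Incident ends v e → supply s' v ≡ supply s v ℤ.- t
    supply-push-source v∈e = begin
      supply s' v
        ≡⟨ supply-push v ⟩
      supply s v ℤ.+ (inflow s' v e ℤ.- inflow s v e)
        ≡⟨ cong₂ (λ y z → supply s v ℤ.+ (y ℤ.- z)) (inflow-incident s' v∈e) (inflow-incident s v∈e) ⟩
      supply s v ℤ.+ (- fOut s' e v ℤ.- - fOut s e v)
        ≡⟨ cong (λ y → supply s v ℤ.+ (- y ℤ.- - fOut s e v)) fOut-push-source ⟩
      supply s v ℤ.+ (- (fOut s e v ℤ.+ t) ℤ.- - fOut s e v)
        ≡⟨ source-balance (supply s v) (fOut s e v) t ⟩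
      supply s v ℤ.- t ∎
      where
      open ≡-Reasoning
      source-balance : ∀ S φ t → S ℤ.+ (- (φ ℤ.+ t) ℤ.- - φ) ≡ S ℤ.- t
      source-balance = solve-∀

    supply-push-target : supply s' u ≡ supply s u ℤ.+ t
    supply-push-target = begin
      supply s' u
        ≡⟨ supply-push u ⟩
      supply s u ℤ.+ (inflow s' u e ℤ.- inflow s u e)
        ≡⟨ cong₂ (λ y z → supply s u ℤ.+ (y ℤ.- z)) (inflow-incident s' u∈e) (inflow-incident s u∈e) ⟩
      supply s u ℤ.+ (- fOut s' e u ℤ.- - fOut s e u)
        ≡⟨ cong₂ (λ y z → supply s u ℤ.+ (- y ℤ.- - z)) (fOut-other s' e v) (fOut-other s e v) ⟩
      supply s u ℤ.+ (- - fOut s' e v ℤ.- - - fOut s e v)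
        ≡⟨ cong (λ y → supply s u ℤ.+ (- - y ℤ.- - - fOut s e v)) fOut-push-source ⟩
      supply s u ℤ.+ (- - (fOut s e v ℤ.+ t) ℤ.- - - fOut s e v)
        ≡⟨ target-balance (supply s u) (fOut s e v) t ⟩
      supply s u ℤ.+ t ∎
      where
      open ≡-Reasoning
      u∈e : Incident ends u e
      u∈e = other-incident e v
      target-balance : ∀ S φ t → S ℤ.+ (- - (φ ℤ.+ t) ℤ.- - - φ) ≡ S ℤ.+ t
      target-balance = solve-∀

    supply-push-elsewhere : Incident ends v e → ∀ x → x ≢ v → x ≢ u → supply s' x ≡ supply s x
    supply-push-elsewhere v∈e x x≢v x≢u = begin
      supply s' x
        ≡⟨ supply-push x ⟩
      supply s x ℤ.+ (inflow s' x e ℤ.- inflow s x e)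
        ≡⟨ cong₂ (λ y z → supply s x ℤ.+ (y ℤ.- z)) (inflow-not-incident s' x∉e) (inflow-not-incident s x∉e) ⟩
      supply s x ℤ.+ + 0
        ≡⟨ ℤP.+-identityʳ (supply s x) ⟩
      supply s x ∎
      where
      open ≡-Reasoning
      x∉e : ¬ Incident ends x e
      x∉e x∈e = x≢u (incident-endpoint v∈e x∈e x≢v)

module Amortisation (G : Graph) (Δ : Fin (Graph.n G) → ℕ) (U h w : ℕ)
                    (2≤w : 2 ≤ w) (Δ≤wd : ∀ v → Δ v ≤ w * Graph.deg G v) where
  open Graph G
  open UnitFlow G Δ U h w
  open GraphFacts G
  open FlowBookkeeping G Δ U h w

  W : Fin n → ℕ
  W x = w * deg x

  excess⇒deg<supply : ∀ s x → + 0 ℤ.< ex s x → + deg x ℤ.< supply s x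
  excess⇒deg<supply s x 0<ex = 0<i-j⇒j<i (ℤP.≰⇒> λ S-d≤0 → ℤP.<⇒≱ 0<ex (ℤP.⊔-lub S-d≤0 ℤP.≤-refl))

  excess-value : ∀ s x → + 0 ℤ.< ex s x → ex s x ≡ supply s x ℤ.- + deg x
  excess-value s x 0<ex = ℤP.i≥j⇒i⊔j≡i (ℤP.<⇒≤ (j<i⇒0<i-j (excess⇒deg<supply s x 0<ex)))

  no-excess⇒supply≤deg : ∀ s x → ¬ (+ 0 ℤ.< ex s x) → supply s x ℤ.≤ + deg x
  no-excess⇒supply≤deg s x ¬0<ex = ℤP.≮⇒≥ λ d<S → ¬0<ex (ℤP.<-≤-trans (j<i⇒0<i-j d<S) (ℤP.i≤i⊔j _ _))

  Touched : Fin n → ℤ → Set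
  Touched x S = 0 < deg x × 0 < h × + deg x ℤ.≤ S

  record VertexInvariant (x : Fin n) (L C : ℕ) (S : ℤ) : Set where
    field
      supply-nonneg : + 0 ℤ.≤ S
      supply-capped : S ℤ.≤ + W x
      label≤h       : L ≤ h
      current≤deg   : C ≤ deg x
      fresh⊎touched : (L ≡ 0 × C ≡ 0) ⊎ Touched x S
  open VertexInvariant

  record Invariant (s : State) : Set where
    field
      at           : ∀ x → VertexInvariant x (l s x) (cur s x) (supply s x)
      conservation : sum (supply s) ≡ + total Δ
  open Invariant

  touched-invariant : ∀ {x L C S} → L ≤ h → C ≤ deg x → Touched x S → S ℤ.≤ + W x → VertexInvariant x L C S
  touched-invariant L≤h C≤d T@(_ , _ , d≤S) S≤W = record
    { supply-nonneg = ℤP.≤-trans (+≤+ z≤n) d≤S ; supply-capped = S≤W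
    ; label≤h = L≤h ; current≤deg = C≤d ; fresh⊎touched = inj₂ T }

  raise-supply : ∀ {x L C S S'} → S ℤ.≤ S' → S' ℤ.≤ + W x → VertexInvariant x L C S → VertexInvariant x L C S'
  raise-supply S≤S' S'≤W V = record
    { supply-nonneg = ℤP.≤-trans (supply-nonneg V) S≤S' ; supply-capped = S'≤W
    ; label≤h = label≤h V ; current≤deg = current≤deg V
    ; fresh⊎touched = Data.Sum.map₂ (λ { (0<d , 0<h , d≤S) → 0<d , 0<h , ℤP.≤-trans d≤S S≤S' }) (fresh⊎touched V) }

  active-touched : ∀ {s v} → Invariant s → Active s v → Touched v (supply s v)
  active-touched {s} {v} I (l<h , 0<ex) = 0<d , ℕP.≤-<-trans z≤n l<h , ℤP.<⇒≤ d<S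
    where
    d<S : + deg v ℤ.< supply s v
    d<S = excess⇒deg<supply s v 0<ex
    0<d : 0 < deg v
    0<d = m<n*m⇒0<m {n = w} (ℤP.drop‿+<+ (ℤP.<-≤-trans d<S (supply-capped (at I v))))

  φ : Fin n → ℕ → ℕ → ℤ → ℤ
  φ x L C S = + (L * suc (deg x) ℕ.+ C) ℤ.+ + 2 ℤ.* ((+ W x ℤ.- S) ℤ.* + L)

  potential : State → Fin n → ℤ
  potential s x = φ x (l s x) (cur s x) (supply s x)

  Φ : State → ℤ
  Φ s = sum (potential s)

  φ-fresh : ∀ x S → φ x 0 0 S ≡ + 0
  φ-fresh x S = trans (ℤP.+-identityˡ _) (trans (cong (ℤ._*_ (+ 2)) (ℤP.*-zeroʳ (+ W x ℤ.- S))) (ℤP.*-zeroʳ (+ 2)))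

  φ-advance : ∀ x L C S → φ x L (suc C) S ≡ + 1 ℤ.+ φ x L C S
  φ-advance x L C S = trans (cong (λ A → + A ℤ.+ room) (ℕP.+-suc (L * suc (deg x)) C))
                            (ℤP.+-assoc (+ 1) (+ (L * suc (deg x) ℕ.+ C)) room)
    where
    room : ℤ
    room = + 2 ℤ.* ((+ W x ℤ.- S) ℤ.* + L)

  φ-relabel : ∀ x L C S → C ≤ deg x → S ℤ.≤ + W x → + 1 ℤ.+ φ x L C S ℤ.≤ φ x (suc L) 0 S
  φ-relabel x L C S C≤d S≤W =
    ≤-by-difference (ℤP.+-mono-≤ (ℤP.i≤j⇒0≤j-i (+≤+ labels)) (ℤP.*-monoˡ-≤-nonNeg (+ 2) (ℤP.i≤j⇒0≤j-i S≤W)))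
                    (regroup (+ (L * suc (deg x) ℕ.+ C)) (+ (suc L * suc (deg x) ℕ.+ 0)) (+ W x) S (+ L))
    where
    labels : suc (L * suc (deg x) ℕ.+ C) ≤ suc L * suc (deg x) ℕ.+ 0
    labels = begin
      suc (L * suc (deg x) ℕ.+ C)       ≤⟨ s≤s (ℕP.+-monoʳ-≤ (L * suc (deg x)) C≤d) ⟩
      suc (L * suc (deg x) ℕ.+ deg x)   ≡⟨ cong suc (ℕP.+-comm (L * suc (deg x)) (deg x)) ⟩
      suc L * suc (deg x)               ≡⟨ ℕP.+-identityʳ _ ⟨
      suc L * suc (deg x) ℕ.+ 0         ∎
      where open ℕP.≤-Reasoning
    regroup : ∀ A A' W S L → A' ℤ.+ + 2 ℤ.* ((W ℤ.- S) ℤ.* (+ 1 ℤ.+ L)) ℤ.- (+ 1 ℤ.+ (A ℤ.+ + 2 ℤ.* ((W ℤ.- S) ℤ.* L)))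
                             ≡ (A' ℤ.- (+ 1 ℤ.+ A)) ℤ.+ + 2 ℤ.* (W ℤ.- S)
    regroup = solve-∀

  φ-send : ∀ x L C S t → φ x L C (S ℤ.- t) ℤ.- φ x L C S ≡ + 2 ℤ.* (t ℤ.* + L)
  φ-send x L C S t = gain (+ (L * suc (deg x) ℕ.+ C)) (+ W x) S t (+ L)
    where
    gain : ∀ A W S t L → A ℤ.+ + 2 ℤ.* ((W ℤ.- (S ℤ.- t)) ℤ.* L) ℤ.- (A ℤ.+ + 2 ℤ.* ((W ℤ.- S) ℤ.* L))
                         ≡ + 2 ℤ.* (t ℤ.* L)
    gain = solve-∀

  φ-receive : ∀ x L C S t → φ x L C (S ℤ.+ t) ℤ.- φ x L C S ≡ - (+ 2 ℤ.* (t ℤ.* + L))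
  φ-receive x L C S t = loss (+ (L * suc (deg x) ℕ.+ C)) (+ W x) S t (+ L)
    where
    loss : ∀ A W S t L → A ℤ.+ + 2 ℤ.* ((W ℤ.- (S ℤ.+ t)) ℤ.* L) ℤ.- (A ℤ.+ + 2 ℤ.* ((W ℤ.- S) ℤ.* L))
                         ≡ - (+ 2 ℤ.* (t ℤ.* L))
    loss = solve-∀

  φ-on-ℕ : ∀ x L C {s} → s ≤ W x → φ x L C (+ s) ≡ + (L * suc (deg x) ℕ.+ C ℕ.+ 2 * ((W x ℕ.∸ s) * L))
  φ-on-ℕ x L C {s} s≤W = begin
    + A ℤ.+ + 2 ℤ.* ((+ W x ℤ.- + s) ℤ.* + L)
      ≡⟨ cong (λ r → + A ℤ.+ + 2 ℤ.* (r ℤ.* + L)) (trans (ℤP.m-n≡m⊖n (W x) s) (ℤP.⊖-≥ s≤W)) ⟩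
    + A ℤ.+ + 2 ℤ.* (+ (W x ℕ.∸ s) ℤ.* + L)
      ≡⟨ cong (λ r → + A ℤ.+ + 2 ℤ.* r) (ℤP.pos-* (W x ℕ.∸ s) L) ⟨
    + A ℤ.+ + 2 ℤ.* + ((W x ℕ.∸ s) * L)
      ≡⟨ cong (ℤ._+_ (+ A)) (ℤP.pos-* 2 ((W x ℕ.∸ s) * L)) ⟨
    + A ℤ.+ + (2 * ((W x ℕ.∸ s) * L))
      ≡⟨ ℤP.pos-+ A (2 * ((W x ℕ.∸ s) * L)) ⟨
    + (A ℕ.+ 2 * ((W x ℕ.∸ s) * L)) ∎
    where
    open ≡-Reasoning
    A = L * suc (deg x) ℕ.+ C

  φ-bound : ∀ {x L C S} → VertexInvariant x L C S → φ x L C S ℤ.≤ + (4 * w * h) ℤ.* S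
  φ-bound {x} {L} {C} {S} V with fresh⊎touched V
  ... | inj₁ (refl , refl) = begin
    φ x 0 0 S                ≡⟨ φ-fresh x S ⟩
    + 0                      ≡⟨ ℤP.*-zeroʳ (+ (4 * w * h)) ⟨
    + (4 * w * h) ℤ.* + 0    ≤⟨ ℤP.*-monoˡ-≤-nonNeg (+ (4 * w * h)) (supply-nonneg V) ⟩
    + (4 * w * h) ℤ.* S      ∎
    where open ℤP.≤-Reasoning
  ... | inj₂ (0<d , 0<h , d≤S) = begin
    φ x L C S
      ≡⟨ cong (φ x L C) S≡s ⟨
    φ x L C (+ s)
      ≡⟨ φ-on-ℕ x L C s≤W ⟩
    + (L * suc (deg x) ℕ.+ C ℕ.+ 2 * ((W x ℕ.∸ s) * L))
      ≤⟨ +≤+ (potential-bound 2≤w 0<h 0<d d≤s (label≤h V) (current≤deg V)) ⟩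
    + (4 * w * h * s)
      ≡⟨ ℤP.pos-* (4 * w * h) s ⟩
    + (4 * w * h) ℤ.* + s
      ≡⟨ cong (ℤ._*_ (+ (4 * w * h))) S≡s ⟩
    + (4 * w * h) ℤ.* S ∎
    where
    open ℤP.≤-Reasoning
    s : ℕ
    s = ℤ.∣ S ∣
    S≡s : + s ≡ S
    S≡s = ℤP.0≤i⇒+∣i∣≡i (supply-nonneg V)
    s≤W : s ≤ W x
    s≤W = ℤP.drop‿+≤+ (subst (ℤ._≤ + W x) (sym S≡s) (supply-capped V))
    d≤s : deg x ≤ s
    d≤s = ℤP.drop‿+≤+ (subst (+ deg x ℤ.≤_) (sym S≡s) d≤S)

  setLabels : State → (Fin n → ℕ) → (Fin n → ℕ) → State
  setLabels s L' C' = record s { l = L' ; cur = C' }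

  label-or-pointer-step : ∀ {s v} (L' C' : Fin n → ℕ) → Invariant s → Active s v →
    (∀ x → x ≢ v → L' x ≡ l s x) → (∀ x → x ≢ v → C' x ≡ cur s x) → L' v ≤ h → C' v ≤ deg v →
    + 1 ℤ.+ potential s v ℤ.≤ potential (setLabels s L' C') v →
    (+ 1 ℤ.+ Φ s ℤ.≤ Φ (setLabels s L' C')) × Invariant (setLabels s L' C')
  label-or-pointer-step {s} {v} L' C' I act L'≡l C'≡cur L'≤h C'≤d gain =
    subst (+ 1 ℤ.+ Φ s ℤ.≤_) (sym (sum-update (potential s) (potential s') v unchanged))
          (≤-add-difference {+ 1} {potential s v} {potential s' v} {Φ s} gain) ,
    record { at = at' ; conservation = conservation I }
    where
    s' : State
    s' = setLabels s L' C'
    unchanged : ∀ x → x ≢ v → potential s' x ≡ potential s x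
    unchanged x x≢v = cong₂ (λ L C → φ x L C (supply s x)) (L'≡l x x≢v) (C'≡cur x x≢v)
    at' : ∀ x → VertexInvariant x (L' x) (C' x) (supply s x)
    at' x with x ≟ v
    ... | yes refl = touched-invariant L'≤h C'≤d (active-touched I act) (supply-capped (at I x))
    ... | no  x≢v  = subst₂ (λ L C → VertexInvariant x L C (supply s x)) (sym (L'≡l x x≢v)) (sym (C'≡cur x x≢v)) (at I x)

  advance-step : ∀ {s v} → Invariant s → Active s v → suc (cur s v) < length (inc v) →
    let C' = update (cur s) v (suc (cur s v)) in
    (+ 1 ℤ.+ Φ s ℤ.≤ Φ (setLabels s (l s) C')) × Invariant (setLabels s (l s) C')
  advance-step {s} {v} I act next<len =
    label-or-pointer-step (l s) C' I act (λ _ _ → refl) (λ _ → update-≢ (cur s) _) (label≤h (at I v)) C'v≤d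
      (ℤP.≤-reflexive (sym (trans (cong (λ C → φ v (l s v) C (supply s v)) C'v≡) (φ-advance v (l s v) (cur s v) (supply s v)))))
    where
    C' = update (cur s) v (suc (cur s v))
    C'v≡ : C' v ≡ suc (cur s v)
    C'v≡ = update-≡ (cur s) v _
    C'v≤d : C' v ≤ deg v
    C'v≤d = subst₂ _≤_ (sym C'v≡) (length-inc v) (ℕP.<⇒≤ next<len)

  relabel-step : ∀ {s v} → Invariant s → Active s v →
    let L' = update (l s) v (suc (l s v)) ; C' = update (cur s) v 0 in
    (+ 1 ℤ.+ Φ s ℤ.≤ Φ (setLabels s L' C')) × Invariant (setLabels s L' C')
  relabel-step {s} {v} I act@(l<h , _) =
    label-or-pointer-step L' C' I act (λ _ → update-≢ (l s) _) (λ _ → update-≢ (cur s) _)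
      (subst (_≤ h) (sym L'v≡) l<h) (subst (_≤ deg v) (sym C'v≡) z≤n)
      (subst₂ (λ L C → + 1 ℤ.+ φ v (l s v) (cur s v) (supply s v) ℤ.≤ φ v L C (supply s v)) (sym L'v≡) (sym C'v≡)
              (φ-relabel v (l s v) (cur s v) (supply s v) (current≤deg (at I v)) (supply-capped (at I v))))
    where
    L' = update (l s) v (suc (l s v))
    C' = update (cur s) v 0
    L'v≡ : L' v ≡ suc (l s v)
    L'v≡ = update-≡ (l s) v _
    C'v≡ : C' v ≡ 0
    C'v≡ = update-≡ (cur s) v 0

  module PushStep {s v e} (I : Invariant s) (act : Active s v) (minimal : ∀ x → Active s x → l s v ≤ l s x)
                  (cur≡e : nth (inc v) (cur s v) ≡ just e) (cond : PushCond s v e) where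
    private
      s' : State
      s' = pushState s v e
      t : ℤ
      t = ψ s v e
      u : Fin n
      u = other e v
      Sv Su : ℤ
      Sv = supply s v
      Su = supply s u

    v∈e : Incident ends v e
    v∈e = incident-of-∈ (nth-∈ (inc v) (cur s v) cur≡e)

    l-source : l s v ≡ suc (l s u)
    l-source = proj₂ (proj₂ cond)

    target-inactive : ¬ (+ 0 ℤ.< ex s u)
    target-inactive 0<ex = ℕP.<-irrefl refl (subst (_≤ l s u) l-source (minimal u (lu<h , 0<ex)))
      where
      lu<h : l s u < h
      lu<h = ℕP.<-trans (subst (l s u <_) (sym l-source) (ℕP.n<1+n _)) (proj₁ act)

    room-at-target : + 1 ℤ.≤ + W u ℤ.- Su
    room-at-target =
      ≤-by-difference (ℤP.+-mono-≤ (ℤP.i≤j⇒0≤j-i (+≤+ (m<n*m (deg-pos (other-incident e v)) 2≤w)))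
                                   (ℤP.i≤j⇒0≤j-i (no-excess⇒supply≤deg s u target-inactive)))
                      (regroup (+ W u) Su (+ deg u))
      where
      regroup : ∀ W S d → W ℤ.- S ℤ.- + 1 ≡ (W ℤ.- (+ 1 ℤ.+ d)) ℤ.+ (d ℤ.- S)
      regroup = solve-∀

    1≤t : + 1 ℤ.≤ t
    1≤t = ℤP.⊓-glb (ℤP.⊓-glb excess residual) room-at-target
      where
      excess   = ℤP.i<j⇒suc[i]≤j (proj₁ cond)
      residual = ℤP.i<j⇒suc[i]≤j (proj₁ (proj₂ cond))

    0≤t : + 0 ℤ.≤ t
    0≤t = ℤP.≤-trans (+≤+ z≤n) 1≤t

    t≤excess : t ℤ.≤ Sv ℤ.- + deg v
    t≤excess = subst (t ℤ.≤_) (excess-value s v (proj₁ cond)) (ℤP.≤-trans (ℤP.i⊓j≤i _ _) (ℤP.i⊓j≤i _ _))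

    t≤room : t ℤ.≤ + W u ℤ.- Su
    t≤room = ℤP.i⊓j≤j _ _

    source : supply s' v ≡ Sv ℤ.- t
    source = supply-push-source s v e v∈e

    target : supply s' u ≡ Su ℤ.+ t
    target = supply-push-target s v e

    elsewhere : ∀ x → x ≢ v → x ≢ u → supply s' x ≡ supply s x
    elsewhere = supply-push-elsewhere s v e v∈e

    source-invariant : VertexInvariant v (l s v) (cur s v) (Sv ℤ.- t)
    source-invariant = touched-invariant (label≤h (at I v)) (current≤deg (at I v)) (0<d , 0<h , d≤Sv-t)
                         (ℤP.≤-trans Sv-t≤Sv (supply-capped (at I v)))
      where
      0<d = proj₁ (active-touched I act)
      0<h = proj₁ (proj₂ (active-touched I act))
      d≤Sv-t : + deg v ℤ.≤ Sv ℤ.- t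
      d≤Sv-t = ≤-by-difference (ℤP.i≤j⇒0≤j-i t≤excess) (swap Sv t (+ deg v))
        where
        swap : ∀ S t d → S ℤ.- t ℤ.- d ≡ S ℤ.- d ℤ.- t
        swap = solve-∀
      Sv-t≤Sv : Sv ℤ.- t ℤ.≤ Sv
      Sv-t≤Sv = ≤-by-difference 0≤t (cancel Sv t)
        where
        cancel : ∀ S t → S ℤ.- (S ℤ.- t) ≡ t
        cancel = solve-∀

    target-invariant : VertexInvariant u (l s u) (cur s u) (Su ℤ.+ t)
    target-invariant = raise-supply (≤-by-difference 0≤t (cancel Su t))
                                    (≤-by-difference (ℤP.i≤j⇒0≤j-i t≤room) (regroup (+ W u) Su t)) (at I u)
      where
      cancel : ∀ S t → S ℤ.+ t ℤ.- S ≡ t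
      cancel = solve-∀
      regroup : ∀ W S t → W ℤ.- (S ℤ.+ t) ≡ W ℤ.- S ℤ.- t
      regroup = solve-∀

    invariant : Invariant s'
    invariant = record { at = at' ; conservation = conserved }
      where
      at' : ∀ x → VertexInvariant x (l s x) (cur s x) (supply s' x)
      at' x with x ≟ v | x ≟ u
      ... | yes refl | _        = subst (VertexInvariant x _ _) (sym source) source-invariant
      ... | no  _    | yes refl = subst (VertexInvariant x _ _) (sym target) target-invariant
      ... | no  x≢v  | no  x≢u  = subst (VertexInvariant x _ _) (sym (elsewhere x x≢v x≢u)) (at I x)
      conserved : sum (supply s') ≡ + total Δ
      conserved = begin
        sum (supply s')
          ≡⟨ sum-update₂ (supply s) (supply s') v u (other-≢ e v) elsewhere ⟩
        sum (supply s) ℤ.+ (supply s' v ℤ.- Sv) ℤ.+ (supply s' u ℤ.- Su)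
          ≡⟨ cong₂ (λ y z → sum (supply s) ℤ.+ (y ℤ.- Sv) ℤ.+ (z ℤ.- Su)) source target ⟩
        sum (supply s) ℤ.+ (Sv ℤ.- t ℤ.- Sv) ℤ.+ (Su ℤ.+ t ℤ.- Su)
          ≡⟨ cancel (sum (supply s)) Sv Su t ⟩
        sum (supply s)
          ≡⟨ conservation I ⟩
        + total Δ ∎
        where
        open ≡-Reasoning
        cancel : ∀ Σ Sv Su t → Σ ℤ.+ (Sv ℤ.- t ℤ.- Sv) ℤ.+ (Su ℤ.+ t ℤ.- Su) ≡ Σ
        cancel = solve-∀

    Φ-push : Φ s' ≡ Φ s ℤ.+ (t ℤ.+ t)
    Φ-push = begin
      Φ s'
        ≡⟨ sum-update₂ (potential s) (potential s') v u (other-≢ e v) unchanged ⟩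
      Φ s ℤ.+ (potential s' v ℤ.- potential s v) ℤ.+ (potential s' u ℤ.- potential s u)
        ≡⟨ cong₂ (λ y z → Φ s ℤ.+ y ℤ.+ z) sent received ⟩
      Φ s ℤ.+ + 2 ℤ.* (t ℤ.* (+ 1 ℤ.+ + l s u)) ℤ.+ - (+ 2 ℤ.* (t ℤ.* + l s u))
        ≡⟨ regroup (Φ s) t (+ l s u) ⟩
      Φ s ℤ.+ (t ℤ.+ t) ∎
      where
      open ≡-Reasoning
      unchanged : ∀ x → x ≢ v → x ≢ u → potential s' x ≡ potential s x
      unchanged x x≢v x≢u = cong (φ x (l s x) (cur s x)) (elsewhere x x≢v x≢u)
      sent : potential s' v ℤ.- potential s v ≡ + 2 ℤ.* (t ℤ.* (+ 1 ℤ.+ + l s u))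
      sent = trans (cong (λ S → φ v (l s v) (cur s v) S ℤ.- potential s v) source)
                   (trans (φ-send v (l s v) (cur s v) Sv t) (cong (λ L → + 2 ℤ.* (t ℤ.* + L)) l-source))
      received : potential s' u ℤ.- potential s u ≡ - (+ 2 ℤ.* (t ℤ.* + l s u))
      received = trans (cong (λ S → φ u (l s u) (cur s u) S ℤ.- potential s u) target) (φ-receive u (l s u) (cur s u) Su t)
      regroup : ∀ Φ t L → Φ ℤ.+ + 2 ℤ.* (t ℤ.* (+ 1 ℤ.+ L)) ℤ.+ - (+ 2 ℤ.* (t ℤ.* L)) ≡ Φ ℤ.+ (t ℤ.+ t)
      regroup = solve-∀

    gain : + suc ℤ.∣ t ∣ ℤ.+ Φ s ℤ.≤ Φ s'
    gain = subst₂ (λ c Φ' → c ℤ.+ Φ s ℤ.≤ Φ') (cong (ℤ._+_ (+ 1)) (sym (ℤP.0≤i⇒+∣i∣≡i 0≤t))) (sym Φ-push)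
             (≤-by-difference (ℤP.i≤j⇒0≤j-i 1≤t) (regroup (Φ s) t))
      where
      regroup : ∀ Φ t → Φ ℤ.+ (t ℤ.+ t) ℤ.- (+ 1 ℤ.+ t ℤ.+ Φ) ≡ t ℤ.- + 1
      regroup = solve-∀

  step-amortised : ∀ {s c s'} → Invariant s → Step s c s' → (+ c ℤ.+ Φ s ℤ.≤ Φ s') × Invariant s'
  step-amortised I (push (act , minimal) cur≡e cond) = gain , invariant
    where open PushStep I act minimal cur≡e cond
  step-amortised I (advance (act , _) _ next<len) = advance-step I act next<len
  step-amortised I (relabel (act , _) _ _)        = relabel-step I act

  run-amortised : ∀ {s k s'} → Invariant s → Run s k s' → (+ k ℤ.+ Φ s ℤ.≤ Φ s') × Invariant s'
  run-amortised I done = ℤP.≤-reflexive (ℤP.+-identityˡ _) , I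
  run-amortised {s} I (step {c = c} {k = k} st run) with step-amortised I st
  ... | first , I' with run-amortised I' run
  ... | rest , I″ = ℤP.≤-trans (ℤP.≤-reflexive (regroup c k (Φ s))) (ℤP.≤-trans (ℤP.+-monoʳ-≤ (+ k) first) rest) , I″
    where
    regroup : ∀ c k Φ → + (c ℕ.+ k) ℤ.+ Φ ≡ + k ℤ.+ (+ c ℤ.+ Φ)
    regroup c k Φ = trans (cong (ℤ._+ Φ) (ℤP.pos-+ c k)) (commute (+ c) (+ k) Φ)
      where
      commute : ∀ c k Φ → c ℤ.+ k ℤ.+ Φ ≡ k ℤ.+ (c ℤ.+ Φ)
      commute = solve-∀

  supply-init : ∀ x → supply init x ≡ + Δ x
  supply-init x = begin
    supply init x                    ≡⟨ supply-as-sum init x ⟩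
    + Δ x ℤ.+ sum (inflow init x)    ≡⟨ cong (ℤ._+_ (+ Δ x)) (trans (sum-cong-≗ no-flow) (sum-replicate-zero m)) ⟩
    + Δ x ℤ.+ + 0                    ≡⟨ ℤP.+-identityʳ (+ Δ x) ⟩
    + Δ x                            ∎
    where
    open ≡-Reasoning
    no-flow : ∀ e → inflow init x e ≡ + 0
    no-flow e = trans (cong (λ y → if does (incident? ends x e) then - y else + 0) (if-eta (does (proj₁ (ends e) ≟ x))))
                      (if-eta (does (incident? ends x e)))

  invariant-init : Invariant init
  invariant-init = record
    { at = λ x → record
        { supply-nonneg = subst (+ 0 ℤ.≤_) (sym (supply-init x)) (+≤+ z≤n)
        ; supply-capped = subst (ℤ._≤ + W x) (sym (supply-init x)) (+≤+ (Δ≤wd x))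
        ; label≤h = z≤n ; current≤deg = z≤n ; fresh⊎touched = inj₁ (refl , refl) }
    ; conservation = trans (sum-cong-≗ supply-init) (sym (+-total Δ)) }

  Φ-init : Φ init ≡ + 0
  Φ-init = trans (sum-cong-≗ λ x → φ-fresh x (supply init x)) (sum-replicate-zero n)

  Φ-bound : ∀ {s} → Invariant s → Φ s ℤ.≤ + (4 * w * h * total Δ)
  Φ-bound {s} I = begin
    Φ s                                       ≤⟨ sum-mono-≤ (λ x → φ-bound (at I x)) ⟩
    sum (λ x → + (4 * w * h) ℤ.* supply s x)  ≡⟨ *-distribˡ-sum (+ (4 * w * h)) (supply s) ⟨
    + (4 * w * h) ℤ.* sum (supply s)          ≡⟨ cong (ℤ._*_ (+ (4 * w * h))) (conservation I) ⟩
    + (4 * w * h) ℤ.* + total Δ               ≡⟨ ℤP.pos-* (4 * w * h) (total Δ) ⟨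
    + (4 * w * h * total Δ)                   ∎
    where open ℤP.≤-Reasoning

  cost-bound : ∀ {s k} → Run init k s → k ≤ 4 * w * h * total Δ
  cost-bound {s} {k} run with run-amortised invariant-init run
  ... | k+Φ≤Φ , I = ℤP.drop‿+≤+ (begin
    + k                 ≡⟨ trans (cong (ℤ._+_ (+ k)) Φ-init) (ℤP.+-identityʳ (+ k)) ⟨
    + k ℤ.+ Φ init      ≤⟨ k+Φ≤Φ ⟩
    Φ s                 ≤⟨ Φ-bound I ⟩
    + (4 * w * h * total Δ) ∎)
    where open ℤP.≤-Reasoning

lemma1 : ∃ λ (C : ℕ) →
    (G : Graph) (Δ : Fin (Graph.n G) → ℕ) (U h w : ℕ) →
    0 < U → 2 ≤ w → (∀ v → Δ v ≤ w * Graph.deg G v) →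
    ∀ {s k} → UnitFlow.Run G Δ U h w (UnitFlow.init G Δ U h w) k s →
    k ≤ C * w * total Δ * h
lemma1 = 4 , λ G Δ U h w _ 2≤w Δ≤wd {_} {k} run →
  subst (k ≤_) (reorder w h (total Δ)) (Amortisation.cost-bound G Δ U h w 2≤w Δ≤wd run)
  where
  reorder : ∀ w h T → 4 * w * h * T ≡ 4 * w * T * h
  reorder = ℕSolver.solve-∀
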